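{- Let $n\ge 2$. For any single color $x\in\{r,b,y,g,o,s\}$, \[F(J(T_n(\{x\})),q)=\prod_{j=1}^n j!_q=\prod_{1\le i\le j\le k\le n-1}\frac{[i+1]_q}{[i]_q}.\]
   Context: Let $T_n$ be the set of triples $(c_1,c_2,c_3)$ of nonnegative integers with $c_1+c_2+c_3\le n-2$. To the colors $r,g,y,b,o,s$ associate $v_r=(1,0,0)$, $v_g=(0,1,0)$, $v_y=(0,0,1)$, $v_b=(-1,1,0)$, $v_o=(-1,0,1)$, $v_s=(0,1,-1)$. For a set $S$ of colors, $T_n(S)$ is the poset on $T_n$ whose order is the reflexive–transitive closure of $p<p+v_x$ for $x\in S$ and $p,p+v_x\in T_n$. $J(P)$ is the set of order ideals (down-closed subsets, including $\emptyset$) of $P$, and $F(J(P),q)=\sum_{I\in J(P)}q^{|I|}$. Here $[m]_q=1+q+\dots+q^{m-1}$ and $j!_q=[1]_q[2]_q\cdots[j]_q$. -}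

module Defs where

open import Data.Nat using (ℕ; zero; suc; _+_; _*_; _∸_; _^_; _≤_; _≤?_)
open import Data.Bool using (Bool; true; false; if_then_else_)
open import Data.Product using (_×_; _,_; Σ; ∃-syntax)
open import Data.List using (List; []; _∷_; map; filter; concatMap; upTo; length)
open import Data.Nat.ListAction using (sum; product)
open import Data.List.Membership.Propositional using (_∈_)
open import Data.List.Relation.Unary.All using (All)
open import Data.List.Relation.Unary.Unique.Propositional using (Unique)
open import Data.Vec using (Vec; lookup; fromList; toList)
open import Data.Fin using (Fin)
open import Relation.Binary.PropositionalEquality using (_≡_)
open import Relation.Binary.Construct.Closure.ReflexiveTransitive using (Star)

Point : Set
Point = ℕ × ℕ × ℕ

InT : ℕ → Point → Set
InT n (a , b , c) = a + b + c ≤ n ∸ 2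

data Color : Set where
  cr cg cy cb co cs : Color

-- Step x p p'  ⇔  p' = p + v_x  (as integer vectors, with p, p' ∈ ℕ³)
-- v_r=(1,0,0), v_g=(0,1,0), v_y=(0,0,1), v_b=(-1,1,0), v_o=(-1,0,1), v_s=(0,1,-1)
data Step : Color → Point → Point → Set where
  step-r : ∀ {a b c} → Step cr (a , b , c) (suc a , b , c)
  step-g : ∀ {a b c} → Step cg (a , b , c) (a , suc b , c)
  step-y : ∀ {a b c} → Step cy (a , b , c) (a , b , suc c)
  step-b : ∀ {a b c} → Step cb (suc a , b , c) (a , suc b , c)
  step-o : ∀ {a b c} → Step co (suc a , b , c) (a , b , suc c)
  step-s : ∀ {a b c} → Step cs (a , b , suc c) (a , suc b , c)

Cover : ℕ → Color → Point → Point → Set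
Cover n x p p' = InT n p × InT n p' × Step x p p'

Le : ℕ → Color → Point → Point → Set
Le n x = Star (Cover n x)

ptsList : ℕ → List Point
ptsList n =
  concatMap (λ a → concatMap (λ b → map (λ c → (a , b , c))
      (filter (λ c → a + b + c ≤? n ∸ 2) (upTo (suc n)))) (upTo (suc n))) (upTo (suc n))

size : ℕ → ℕ
size n = length (ptsList n)

pts : (n : ℕ) → Vec Point (size n)
pts n = fromList (ptsList n)

-- Subsets of T_n : characteristic vectors indexed by the enumeration
Subset : ℕ → Set
Subset n = Vec Bool (size n)

card : ∀ {m} → Vec Bool m → ℕ
card v = sum (map (λ t → if t then 1 else 0) (toList v))

IsIdeal : (n : ℕ) → Color → Subset n → Set
IsIdeal n x I = (i j : Fin (size n)) → Le n x (lookup (pts n) i) (lookup (pts n) j) →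
                lookup I j ≡ true → lookup I i ≡ true

EnumeratesJ : (n : ℕ) → Color → List (Subset n) → Set
EnumeratesJ n x L = All (IsIdeal n x) L × Unique L × ((I : Subset n) → IsIdeal n x I → I ∈ L)

genF : (n : ℕ) → List (Subset n) → ℕ → ℕ
genF n L q = sum (map (λ I → q ^ card I) L)

qint : ℕ → ℕ → ℕ
qint m q = sum (map (λ k → q ^ k) (upTo m))

qfact : ℕ → ℕ → ℕ
qfact j q = product (map (λ i → qint (suc i) q) (upTo j))

prodFact : ℕ → ℕ → ℕ
prodFact n q = product (map (λ j → qfact (suc j) q) (upTo n))

-- the list of i with 1 ≤ i ≤ j ≤ k ≤ n-1, one entry per triple (i,j,k)
tripleIs : ℕ → List ℕ
tripleIs n =
  concatMap (λ k' → concatMap (λ j' → map suc (upTo (suc j'))) (upTo (suc k'))) (upTo (n ∸ 1))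

prodDen : ℕ → ℕ → ℕ
prodDen n q = product (map (λ i → qint i q) (tripleIs n))

prodNum : ℕ → ℕ → ℕ
prodNum n q = product (map (λ i → qint (suc i) q) (tripleIs n))

open import Relation.Binary.PropositionalEquality using (refl)
_ : size 4 ≡ 10
_ = refl
_ : tripleIs 4 ≡ 1 ∷ 1 ∷ 1 ∷ 2 ∷ 1 ∷ 1 ∷ 2 ∷ 1 ∷ 2 ∷ 3 ∷ []
_ = refl
_ : prodFact 4 2 * prodDen 4 2 ≡ prodNum 4 2
_ = refl
_ : prodFact 2 5 ≡ 6
_ = refl

module Submission where

-- Each colour x has an affine relabelling of T_n (a permutation of the coordinates, possibly
-- composed with the reflection c₁ ↦ (n-2) - (c₁+c₂+c₃)) that carries the covers of T_n({x})
-- onto the vertical steps p < p + (0,0,1). So T_n({x}) is the disjoint union of the chains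
-- {(a,b,c) | c ≤ n-2-a-b}; an order ideal is an initial segment of each chain, of total size the
-- sum of the segment lengths, and F(J(T_n({x})),q) = ∏_{a+b≤n-2} [n-a-b]_q = ∏_a (n-a)!_q.

open import Defs
open import Data.Bool using (Bool; true; false; if_then_else_)
open import Data.Empty using (⊥-elim)
open import Data.Fin using (Fin)
import Data.Fin as Fin
import Data.Vec as Vec
import Data.Vec.Properties as Vec
open import Data.List using (List; []; _∷_; map; filter; concatMap; upTo; applyUpTo; _++_; [_])
import Data.List as List
open import Data.List.Membership.Propositional using (_∈_; find; lose)
open import Data.List.Membership.Propositional.Properties
  using (∈-concatMap⁺; ∈-concatMap⁻; ∈-map⁺; ∈-map⁻; ∈-upTo⁺; ∈-upTo⁻; ∈-filter⁺; ∈-filter⁻; ∈-lookup)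
open import Data.List.Membership.Propositional.Properties.WithK using (unique∧set⇒bag)
open import Data.List.Properties using (map-++; map-∘; map-cong; map-cong-local; upTo-∷ʳ; filter-++; filter-accept; filter-reject; ++-identityʳ; ∷-injectiveʳ)
open import Data.List.Relation.Binary.BagAndSetEquality using (∼bag⇒↭)
open import Data.List.Relation.Binary.Permutation.Propositional.Properties using (map⁺)
open import Data.List.Relation.Binary.Pointwise using (Pointwise; []; _∷_)
open import Data.List.Relation.Unary.All using ([]; _∷_)
import Data.List.Relation.Unary.All as All
import Data.List.Relation.Unary.All.Properties as All
open import Data.List.Relation.Unary.AllPairs using ([]; _∷_)
open import Data.List.Relation.Unary.Any using (here; there)
import Data.List.Relation.Unary.Any as Any
open import Data.List.Relation.Unary.Any.Properties using (lookup-index)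
open import Data.List.Relation.Unary.Unique.Propositional using (Unique)
import Data.List.Relation.Unary.Unique.Propositional.Properties as Unique
open import Data.Nat using (ℕ; zero; suc; _+_; _*_; _∸_; _^_; _≤_; _<_; _≤?_; _<ᵇ_; _⊓_; z≤n; s≤s; z<s; s<s; s≤s⁻¹; s<s⁻¹)
open import Data.Nat.ListAction using (sum; product)
open import Data.Nat.ListAction.Properties using (sum-++; product-++; sum-↭)
open import Data.Nat.Properties
open import Data.Product using (_×_; _,_; ∃-syntax; proj₁; proj₂)
open import Data.Product.Properties using (≡-dec)
open import Function using (_∘_; id; mk⇔)
open import Relation.Binary.PropositionalEquality hiding ([_])
open import Relation.Nullary using (¬_; Dec; yes; no)
open import Algebra.Properties.CommutativeSemigroup +-commutativeSemigroup
  using (xy∙z≈yz∙x; xy∙z≈zx∙y; xy∙z≈xz∙y; xy∙z≈x∙zy; xy∙z≈y∙xz; xy∙z≈z∙xy)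
open import Relation.Binary using (DecidableEquality)
open import Relation.Binary.Construct.Closure.ReflexiveTransitive using (ε; _◅_)

∑< ∏< : ℕ → (ℕ → ℕ) → ℕ
∑< zero    f = 0
∑< (suc m) f = f 0 + ∑< m (f ∘ suc)
∏< zero    f = 1
∏< (suc m) f = f 0 * ∏< m (f ∘ suc)

syntax ∑< m (λ i → e) = ∑[ i < m ] e
syntax ∏< m (λ i → e) = ∏[ i < m ] e

sum-map-applyUpTo : ∀ (f g : ℕ → ℕ) m → sum (map f (applyUpTo g m)) ≡ ∑[ i < m ] f (g i)
sum-map-applyUpTo f g zero    = refl
sum-map-applyUpTo f g (suc m) = cong (f (g 0) +_) (sum-map-applyUpTo f (g ∘ suc) m)

product-map-applyUpTo : ∀ (f g : ℕ → ℕ) m → product (map f (applyUpTo g m)) ≡ ∏[ i < m ] f (g i)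
product-map-applyUpTo f g zero    = refl
product-map-applyUpTo f g (suc m) = cong (f (g 0) *_) (product-map-applyUpTo f (g ∘ suc) m)

sum-map-upTo : ∀ (f : ℕ → ℕ) m → sum (map f (upTo m)) ≡ ∑[ i < m ] f i
sum-map-upTo f = sum-map-applyUpTo f id

product-map-upTo : ∀ (f : ℕ → ℕ) m → product (map f (upTo m)) ≡ ∏[ i < m ] f i
product-map-upTo f = product-map-applyUpTo f id

∑<-cong : ∀ {f g : ℕ → ℕ} m → (∀ {i} → i < m → f i ≡ g i) → ∑[ i < m ] f i ≡ ∑[ i < m ] g i
∑<-cong zero    f≗g = refl
∑<-cong (suc m) f≗g = cong₂ _+_ (f≗g z<s) (∑<-cong m (f≗g ∘ s<s))

∏<-cong : ∀ {f g : ℕ → ℕ} m → (∀ {i} → i < m → f i ≡ g i) → ∏[ i < m ] f i ≡ ∏[ i < m ] g i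
∏<-cong zero    f≗g = refl
∏<-cong (suc m) f≗g = cong₂ _*_ (f≗g z<s) (∏<-cong m (f≗g ∘ s<s))

∏<-suc : ∀ (f : ℕ → ℕ) m → ∏[ i < suc m ] f i ≡ (∏[ i < m ] f i) * f m
∏<-suc f zero    = trans (*-identityʳ (f 0)) (sym (+-identityʳ (f 0)))
∏<-suc f (suc m) = trans (cong (f 0 *_) (∏<-suc (f ∘ suc) m)) (sym (*-assoc (f 0) _ _))

∏<-* : ∀ (f g : ℕ → ℕ) m → ∏[ i < m ] (f i * g i) ≡ (∏[ i < m ] f i) * (∏[ i < m ] g i)
∏<-* f g zero    = refl
∏<-* f g (suc m) = trans (cong (f 0 * g 0 *_) (∏<-* (f ∘ suc) (g ∘ suc) m)) ([m*n]*[o*p]≡[m*o]*[n*p] (f 0) (g 0) _ _)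

∏<-reverse : ∀ (f : ℕ → ℕ) m → ∏[ i < m ] f (m ∸ suc i) ≡ ∏[ i < m ] f i
∏<-reverse f zero    = refl
∏<-reverse f (suc m) = begin
  f m * ∏[ i < m ] f (m ∸ suc i)  ≡⟨ cong (f m *_) (∏<-reverse f m) ⟩
  f m * ∏[ i < m ] f i            ≡⟨ *-comm (f m) _ ⟩
  (∏[ i < m ] f i) * f m          ≡⟨ ∏<-suc f m ⟨
  ∏[ i < suc m ] f i              ∎
  where open ≡-Reasoning

∏<-1 : ∀ m → ∏[ i < m ] 1 ≡ 1
∏<-1 zero    = refl
∏<-1 (suc m) = trans (+-identityʳ _) (∏<-1 m)

∑<-0 : ∀ m → ∑[ i < m ] 0 ≡ 0
∑<-0 zero    = refl
∑<-0 (suc m) = ∑<-0 m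

-- Counting a down-closed boolean predicate on an interval

toℕ : Bool → ℕ
toℕ b = if b then 1 else 0

count : ℕ → (ℕ → Bool) → ℕ
count L f = ∑[ j < L ] toℕ (f j)

count-≤ : ∀ L f → count L f ≤ L
count-≤ zero    f = z≤n
count-≤ (suc L) f with f 0
... | true  = s≤s (count-≤ L (f ∘ suc))
... | false = m≤n⇒m≤1+n (count-≤ L (f ∘ suc))

count-<ᵇ : ∀ {t L} → t ≤ L → count L (_<ᵇ t) ≡ t
count-<ᵇ {zero}  {L}     _         = ∑<-0 L
count-<ᵇ {suc t} {suc L} (s≤s t≤L) = cong suc (count-<ᵇ t≤L)

<ᵇ-pred : ∀ c t → (suc c <ᵇ t) ≡ true → (c <ᵇ t) ≡ true
<ᵇ-pred zero    (suc t) _ = refl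
<ᵇ-pred (suc c) (suc t) p = <ᵇ-pred c t p

DownClosedBelow : ℕ → (ℕ → Bool) → Set
DownClosedBelow L f = ∀ {j} → suc j < L → f (suc j) ≡ true → f j ≡ true

downClosed-false : ∀ {L f} → DownClosedBelow L f → f 0 ≡ false → ∀ {c} → c < L → f c ≡ false
downClosed-false         closed f0 {zero}  _   = f0
downClosed-false {f = f} closed f0 {suc c} c<L with f (suc c) in fc
... | false = refl
... | true  = trans (sym (closed c<L fc)) (downClosed-false closed f0 (<⇒≤ c<L))

downClosed⇒initialSegment : ∀ {L f} → DownClosedBelow L f → ∀ {c} → c < L → f c ≡ (c <ᵇ count L f)
downClosed⇒initialSegment {suc L} {f} closed {c} c<L with f 0 in f0
... | false = trans (downClosed-false closed f0 c<L) (sym (cong (c <ᵇ_) none))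
  where
  none : count L (f ∘ suc) ≡ 0
  none = trans (∑<-cong L (λ j<L → cong toℕ (downClosed-false closed f0 (s<s j<L)))) (∑<-0 L)
downClosed⇒initialSegment {suc L} {f} closed {zero}  c<L | true = f0
downClosed⇒initialSegment {suc L} {f} closed {suc c} c<L | true =
  downClosed⇒initialSegment (closed ∘ s<s) (s<s⁻¹ c<L)

module _ {A B : Set} where

  ∈-concatMap⁺′ : ∀ {f : A → List B} {xs x y} → x ∈ xs → y ∈ f x → y ∈ concatMap f xs
  ∈-concatMap⁺′ {f} {y = y} x∈xs y∈fx = ∈-concatMap⁺ f (lose {P = (y ∈_) ∘ f} x∈xs y∈fx)

  ∈-concatMap⁻′ : ∀ (f : A → List B) xs {y} → y ∈ concatMap f xs → ∃[ x ] (x ∈ xs × y ∈ f x)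
  ∈-concatMap⁻′ f xs y∈ = find (∈-concatMap⁻ f y∈)

  concatMap-Unique : ∀ (f : A → List B) (key : B → A) {xs} → Unique xs →
    (∀ {x} → x ∈ xs → Unique (f x)) → (∀ {x y} → y ∈ f x → key y ≡ x) → Unique (concatMap f xs)
  concatMap-Unique f key {[]}     []             _      _   = []
  concatMap-Unique f key {x ∷ xs} u@(_ ∷ u-xs) unique-f key-f =
    Unique.++⁺ (unique-f (here refl)) (concatMap-Unique f key u-xs (unique-f ∘ there) key-f) disjoint
    where
    disjoint : ∀ {y} → ¬ (y ∈ f x × y ∈ concatMap f xs)
    disjoint (y∈fx , y∈rest) with ∈-concatMap⁻′ f xs y∈rest
    ... | x′ , x′∈xs , y∈fx′ =
      Unique.Unique[x∷xs]⇒x∉xs u (subst (_∈ xs) (trans (sym (key-f y∈fx′)) (key-f y∈fx)) x′∈xs)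

  map-Unique-injectiveOn : ∀ (f : A → B) {xs} → (∀ {x y} → x ∈ xs → y ∈ xs → f x ≡ f y → x ≡ y) →
    Unique xs → Unique (map f xs)
  map-Unique-injectiveOn f {[]}     inj []             = []
  map-Unique-injectiveOn f {x ∷ xs} inj u@(_ ∷ u-xs) =
    All.tabulate fx∉ ∷ map-Unique-injectiveOn f (λ x∈ y∈ → inj (there x∈) (there y∈)) u-xs
    where
    fx∉ : ∀ {z} → z ∈ map f xs → f x ≢ z
    fx∉ z∈ refl with ∈-map⁻ f z∈
    ... | y , y∈xs , fx≡fy = Unique.Unique[x∷xs]⇒x∉xs u (subst (_∈ xs) (sym (inj (here refl) (there y∈xs) fx≡fy)) y∈xs)

  sum-concatMap : ∀ (F : B → ℕ) (g : A → List B) xs →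
    sum (map F (concatMap g xs)) ≡ sum (map (λ x → sum (map F (g x))) xs)
  sum-concatMap F g []       = refl
  sum-concatMap F g (x ∷ xs) = begin
    sum (map F (g x ++ concatMap g xs))                  ≡⟨ cong sum (map-++ F (g x) _) ⟩
    sum (map F (g x) ++ map F (concatMap g xs))          ≡⟨ sum-++ (map F (g x)) _ ⟩
    sum (map F (g x)) + sum (map F (concatMap g xs))     ≡⟨ cong (sum (map F (g x)) +_) (sum-concatMap F g xs) ⟩
    sum (map F (g x)) + sum (map (λ x → sum (map F (g x))) xs) ∎
    where open ≡-Reasoning

  product-concatMap : ∀ (F : B → ℕ) (g : A → List B) xs →
    product (map F (concatMap g xs)) ≡ product (map (λ x → product (map F (g x))) xs)
  product-concatMap F g []       = refl
  product-concatMap F g (x ∷ xs) = begin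
    product (map F (g x ++ concatMap g xs))                  ≡⟨ cong product (map-++ F (g x) _) ⟩
    product (map F (g x) ++ map F (concatMap g xs))          ≡⟨ product-++ (map F (g x)) _ ⟩
    product (map F (g x)) * product (map F (concatMap g xs)) ≡⟨ cong (product (map F (g x)) *_) (product-concatMap F g xs) ⟩
    product (map F (g x)) * product (map (λ x → product (map F (g x))) xs) ∎
    where open ≡-Reasoning

sum-map-Unique-sameElements : ∀ {A : Set} (F : A → ℕ) {xs ys} → Unique xs → Unique ys →
  (∀ {z} → z ∈ xs → z ∈ ys) → (∀ {z} → z ∈ ys → z ∈ xs) → sum (map F xs) ≡ sum (map F ys)
sum-map-Unique-sameElements F u-xs u-ys xs⊆ys ys⊆xs =
  sum-↭ (map⁺ F (∼bag⇒↭ (unique∧set⇒bag u-xs u-ys (mk⇔ xs⊆ys ys⊆xs))))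

sum-map-*ˡ : ∀ {A : Set} c (f : A → ℕ) xs → sum (map (λ x → c * f x) xs) ≡ c * sum (map f xs)
sum-map-*ˡ c f []       = sym (*-zeroʳ c)
sum-map-*ˡ c f (x ∷ xs) = trans (cong (c * f x +_) (sum-map-*ˡ c f xs)) (sym (*-distribˡ-+ c (f x) _))

sum-map-*ʳ : ∀ {A : Set} c (f : A → ℕ) xs → sum (map (λ x → f x * c) xs) ≡ sum (map f xs) * c
sum-map-*ʳ c f []       = refl
sum-map-*ʳ c f (x ∷ xs) = trans (cong (f x * c +_) (sum-map-*ʳ c f xs)) (sym (*-distribʳ-+ c (f x) _))

lookup-injective : ∀ {A : Set} {xs : List A} → Unique xs → ∀ i j → List.lookup xs i ≡ List.lookup xs j → i ≡ j
lookup-injective {xs = _ ∷ _}  _       Fin.zero    Fin.zero    _  = refl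
lookup-injective {xs = _ ∷ xs} u       Fin.zero    (Fin.suc j) eq =
  ⊥-elim (Unique.Unique[x∷xs]⇒x∉xs u (subst (_∈ xs) (sym eq) (∈-lookup j)))
lookup-injective {xs = _ ∷ xs} u       (Fin.suc i) Fin.zero    eq =
  ⊥-elim (Unique.Unique[x∷xs]⇒x∉xs u (subst (_∈ xs) eq (∈-lookup i)))
lookup-injective {xs = _ ∷ _}  (_ ∷ u) (Fin.suc i) (Fin.suc j) eq = cong Fin.suc (lookup-injective u i j eq)

module AssocList {A : Set} (_≟_ : DecidableEquality A) where

  valueAt : List A → List ℕ → A → ℕ
  valueAt []        _        k = 0
  valueAt (_ ∷ _)   []       k = 0
  valueAt (k′ ∷ ks) (h ∷ hs) k with k ≟ k′
  ... | yes _ = h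
  ... | no  _ = valueAt ks hs k

  module _ {R : A → ℕ → Set} where

    valueAt-Pointwise : ∀ {ks hs k} → Pointwise R ks hs → k ∈ ks → R k (valueAt ks hs k)
    valueAt-Pointwise {k′ ∷ _} {_ ∷ _} {k} (r ∷ rs) k∈ with k ≟ k′ | k∈
    ... | yes refl | _          = r
    ... | no  k≢k′ | here k≡k′  = ⊥-elim (k≢k′ k≡k′)
    ... | no  _    | there k∈ks = valueAt-Pointwise rs k∈ks

    map-valueAt : ∀ {ks hs} → Unique ks → Pointwise R ks hs → map (valueAt ks hs) ks ≡ hs
    map-valueAt {[]}      {[]}     []         []       = refl
    map-valueAt {k ∷ ks} {h ∷ hs} u@(_ ∷ u-ks) (_ ∷ rs) =
      cong₂ _∷_ head (trans (map-cong-local (All.tabulate tail)) (map-valueAt u-ks rs))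
      where
      head : valueAt (k ∷ ks) (h ∷ hs) k ≡ h
      head with k ≟ k
      ... | yes _   = refl
      ... | no  k≢k = ⊥-elim (k≢k refl)
      tail : ∀ {k′} → k′ ∈ ks → valueAt (k ∷ ks) (h ∷ hs) k′ ≡ valueAt ks hs k′
      tail {k′} k′∈ks with k′ ≟ k
      ... | yes refl = ⊥-elim (Unique.Unique[x∷xs]⇒x∉xs u k′∈ks)
      ... | no  _    = refl

  valueAt-map : ∀ (f : A → ℕ) {ks k} → k ∈ ks → valueAt ks (map f ks) k ≡ f k
  valueAt-map f {k′ ∷ ks} {k} k∈ with k ≟ k′ | k∈
  ... | yes refl | _          = refl
  ... | no  k≢k′ | here k≡k′  = ⊥-elim (k≢k′ k≡k′)
  ... | no  _    | there k∈ks = valueAt-map f k∈ks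

module BoundedVectors {A : Set} (bound : A → ℕ) where

  Bounded : List A → List ℕ → Set
  Bounded = Pointwise (λ k h → h ≤ bound k)

  map-Bounded : ∀ {f : A → ℕ} → (∀ k → f k ≤ bound k) → ∀ ks → Bounded ks (map f ks)
  map-Bounded f≤ []       = []
  map-Bounded f≤ (k ∷ ks) = f≤ k ∷ map-Bounded f≤ ks

  boundedVectors : List A → List (List ℕ)
  boundedVectors []       = [ [] ]
  boundedVectors (k ∷ ks) = concatMap (λ h → map (h ∷_) (boundedVectors ks)) (upTo (suc (bound k)))

  ∈-boundedVectors⁺ : ∀ {ks hs} → Bounded ks hs → hs ∈ boundedVectors ks
  ∈-boundedVectors⁺ []                          = here refl
  ∈-boundedVectors⁺ {_ ∷ ks} {h ∷ _} (h≤ ∷ bnd) =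
    ∈-concatMap⁺′ {f = λ h → map (h ∷_) (boundedVectors ks)} (∈-upTo⁺ (s≤s h≤)) (∈-map⁺ (h ∷_) (∈-boundedVectors⁺ bnd))

  ∈-boundedVectors⁻ : ∀ ks {hs} → hs ∈ boundedVectors ks → Bounded ks hs
  ∈-boundedVectors⁻ []       (here refl) = []
  ∈-boundedVectors⁻ (k ∷ ks) hs∈ with ∈-concatMap⁻′ (λ h → map (h ∷_) (boundedVectors ks)) (upTo (suc (bound k))) hs∈
  ... | h , h∈ , hs∈′ with ∈-map⁻ (h ∷_) hs∈′
  ... | _ , hs∈ks , refl = s≤s⁻¹ (∈-upTo⁻ h∈) ∷ ∈-boundedVectors⁻ ks hs∈ks

  boundedVectors-Unique : ∀ ks → Unique (boundedVectors ks)
  boundedVectors-Unique []       = [] ∷ []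
  boundedVectors-Unique (k ∷ ks) =
    concatMap-Unique (λ h → map (h ∷_) (boundedVectors ks)) head (Unique.upTo⁺ (suc (bound k)))
      (λ _ → Unique.map⁺ ∷-injectiveʳ (boundedVectors-Unique ks)) head-∷
    where
    head : List ℕ → ℕ
    head []      = 0
    head (h ∷ _) = h
    head-∷ : ∀ {h hs} → hs ∈ map (h ∷_) (boundedVectors ks) → head hs ≡ h
    head-∷ {h} hs∈ with ∈-map⁻ (h ∷_) hs∈
    ... | _ , _ , refl = refl

  sum-boundedVectors : ∀ q ks →
    sum (map (λ hs → q ^ sum hs) (boundedVectors ks)) ≡ product (map (λ k → qint (suc (bound k)) q) ks)
  sum-boundedVectors q []       = refl
  sum-boundedVectors q (k ∷ ks) = begin
    sum (map F (boundedVectors (k ∷ ks)))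
      ≡⟨ sum-concatMap F (λ h → map (h ∷_) (boundedVectors ks)) heights ⟩
    sum (map (λ h → sum (map F (map (h ∷_) (boundedVectors ks)))) heights)
      ≡⟨ cong sum (map-cong column heights) ⟩
    sum (map (λ h → q ^ h * S) heights)
      ≡⟨ sum-map-*ʳ S (q ^_) heights ⟩
    qint (suc (bound k)) q * S
      ≡⟨ cong (qint (suc (bound k)) q *_) (sum-boundedVectors q ks) ⟩
    product (map (λ k → qint (suc (bound k)) q) (k ∷ ks)) ∎
    where
    open ≡-Reasoning
    F : List ℕ → ℕ
    F hs = q ^ sum hs
    heights = upTo (suc (bound k))
    S = sum (map F (boundedVectors ks))
    column : ∀ h → sum (map F (map (h ∷_) (boundedVectors ks))) ≡ q ^ h * S
    column h = begin
      sum (map F (map (h ∷_) (boundedVectors ks)))       ≡⟨ cong sum (map-∘ (boundedVectors ks)) ⟨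
      sum (map (λ hs → q ^ (h + sum hs)) (boundedVectors ks)) ≡⟨ cong sum (map-cong (λ hs → ^-distribˡ-+-* q h (sum hs)) (boundedVectors ks)) ⟩
      sum (map (λ hs → q ^ h * F hs) (boundedVectors ks)) ≡⟨ sum-map-*ˡ (q ^ h) F (boundedVectors ks) ⟩
      q ^ h * S ∎

filter-upTo : ∀ s N m → filter (λ c → s + c ≤? N) (upTo m) ≡ upTo (m ⊓ (suc N ∸ s))
filter-upTo s N zero    = refl
filter-upTo s N (suc m) = begin
  filter P? (upTo (suc m))                   ≡⟨ cong (filter P?) (upTo-∷ʳ m) ⟨
  filter P? (upTo m ++ [ m ])                ≡⟨ filter-++ P? (upTo m) [ m ] ⟩
  filter P? (upTo m) ++ filter P? [ m ]      ≡⟨ cong (_++ filter P? [ m ]) (filter-upTo s N m) ⟩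
  upTo (m ⊓ (suc N ∸ s)) ++ filter P? [ m ]  ≡⟨ last (P? m) ⟩
  upTo (suc m ⊓ (suc N ∸ s))                 ∎
  where
  open ≡-Reasoning
  P? : ∀ c → Dec (s + c ≤ N)
  P? c = s + c ≤? N
  m<bound : s + m ≤ N → m < suc N ∸ s
  m<bound s+m≤N = m+n≤o⇒m≤o∸n (suc m) (subst (λ z → suc z ≤ suc N) (+-comm s m) (s≤s s+m≤N))
  bound≤m : ¬ (s + m ≤ N) → suc N ∸ s ≤ m
  bound≤m s+m≰N = m≤n+o⇒m∸n≤o (suc N) s (≰⇒> s+m≰N)
  last : Dec (s + m ≤ N) → upTo (m ⊓ (suc N ∸ s)) ++ filter P? [ m ] ≡ upTo (suc m ⊓ (suc N ∸ s))
  last (yes s+m≤N) rewrite filter-accept P? {xs = []} s+m≤N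
    | m≤n⇒m⊓n≡m (<⇒≤ (m<bound s+m≤N)) | m≤n⇒m⊓n≡m (m<bound s+m≤N) = upTo-∷ʳ m
  last (no s+m≰N) rewrite filter-reject P? {xs = []} s+m≰N
    | m≥n⇒m⊓n≡n (bound≤m s+m≰N) | m≥n⇒m⊓n≡n (m≤n⇒m≤1+n (bound≤m s+m≰N)) = ++-identityʳ _

<∸⇒+< : ∀ {j} m s → j < m ∸ s → s + j < m
<∸⇒+< m       zero    j<m   = j<m
<∸⇒+< (suc m) (suc s) j<m∸s = s≤s (<∸⇒+< m s j<m∸s)

lookup-fromList : ∀ {A : Set} (xs : List A) i → Vec.lookup (Vec.fromList xs) i ≡ List.lookup xs i
lookup-fromList (_ ∷ _)  Fin.zero    = refl
lookup-fromList (_ ∷ xs) (Fin.suc i) = lookup-fromList xs i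

-- q-factorial identities

∏-qint : ℕ → ℕ → ℕ
∏-qint j q = ∏[ i < j ] qint (suc i) q

qfact≡∏-qint : ∀ j q → qfact j q ≡ ∏-qint j q
qfact≡∏-qint j q = product-map-upTo (λ i → qint (suc i) q) j

prodFact≡∏ : ∀ n q → prodFact n q ≡ ∏[ j < n ] ∏-qint (suc j) q
prodFact≡∏ n q = trans (product-map-upTo (λ j → qfact (suc j) q) n) (∏<-cong n (λ {j} _ → qfact≡∏-qint (suc j) q))

∏-qint-suc : ∀ j q → ∏-qint (suc j) q ≡ ∏[ i < j ] qint (suc (suc i)) q
∏-qint-suc j q = +-identityʳ _

∏-qint-∸ : ∀ q {R m} → R < m → ∏[ b < m ] qint (suc (R ∸ b)) q ≡ ∏-qint (suc R) q
∏-qint-∸ q {zero}  {suc m} _ = cong (1 *_) (∏<-1 m)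
∏-qint-∸ q {suc R} {suc m} R<m = begin
  qint (suc (suc R)) q * ∏[ b < m ] qint (suc (R ∸ b)) q ≡⟨ cong (qint (suc (suc R)) q *_) (∏-qint-∸ q (s<s⁻¹ R<m)) ⟩
  qint (suc (suc R)) q * ∏-qint (suc R) q               ≡⟨ *-comm (qint (suc (suc R)) q) _ ⟩
  ∏-qint (suc R) q * qint (suc (suc R)) q               ≡⟨ ∏<-suc (λ i → qint (suc i) q) (suc R) ⟨
  ∏-qint (suc (suc R)) q                                ∎
  where open ≡-Reasoning

product-tripleIs : ∀ (F : ℕ → ℕ) n →
  product (map F (tripleIs n)) ≡ ∏[ k < n ∸ 1 ] ∏[ j < suc k ] ∏[ i < suc j ] F (suc i)
product-tripleIs F n = begin
  product (map F (concatMap outer (upTo (n ∸ 1))))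
    ≡⟨ product-concatMap F outer (upTo (n ∸ 1)) ⟩
  product (map (λ k → product (map F (outer k))) (upTo (n ∸ 1)))
    ≡⟨ product-map-upTo (λ k → product (map F (outer k))) (n ∸ 1) ⟩
  ∏[ k < n ∸ 1 ] product (map F (outer k))
    ≡⟨ ∏<-cong (n ∸ 1) (λ {k} _ → middle k) ⟩
  ∏[ k < n ∸ 1 ] ∏[ j < suc k ] ∏[ i < suc j ] F (suc i) ∎
  where
  open ≡-Reasoning
  inner : ℕ → List ℕ
  inner j = map suc (upTo (suc j))
  outer : ℕ → List ℕ
  outer k = concatMap inner (upTo (suc k))
  middle : ∀ k → product (map F (outer k)) ≡ ∏[ j < suc k ] ∏[ i < suc j ] F (suc i)
  middle k = begin
    product (map F (outer k))
      ≡⟨ product-concatMap F inner (upTo (suc k)) ⟩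
    product (map (λ j → product (map F (inner j))) (upTo (suc k)))
      ≡⟨ product-map-upTo (λ j → product (map F (inner j))) (suc k) ⟩
    ∏[ j < suc k ] product (map F (inner j))
      ≡⟨ ∏<-cong {λ j → product (map F (inner j))} (suc k) (λ {j} _ → trans (cong product (sym (map-∘ {g = F} {f = suc} (upTo (suc j))))) (product-map-upTo (F ∘ suc) (suc j))) ⟩
    ∏[ j < suc k ] ∏[ i < suc j ] F (suc i) ∎

-- For fixed j the quotients [i+1]_q / [i]_q, i ≤ j, telescope to [j+1]_q; then ∏_{j ≤ k} [j+1]_q = (k+1)!_q.
prodFact*prodDen≡prodNum : ∀ n q → prodFact n q * prodDen n q ≡ prodNum n q
prodFact*prodDen≡prodNum n q = begin
  prodFact n q * prodDen n q
    ≡⟨ *-comm (prodFact n q) _ ⟩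
  prodDen n q * prodFact n q
    ≡⟨ cong₂ _*_ (product-tripleIs (λ i → qint i q) n) (factorials n) ⟩
  (∏[ k < n ∸ 1 ] den k) * (∏[ k < n ∸ 1 ] ∏-qint (suc (suc k)) q)
    ≡⟨ ∏<-* den (λ k → ∏-qint (suc (suc k)) q) (n ∸ 1) ⟨
  ∏[ k < n ∸ 1 ] (den k * ∏-qint (suc (suc k)) q)
    ≡⟨ ∏<-cong (n ∸ 1) (λ {k} _ → telescope k) ⟩
  ∏[ k < n ∸ 1 ] num k
    ≡⟨ product-tripleIs (λ i → qint (suc i) q) n ⟨
  prodNum n q ∎
  where
  open ≡-Reasoning
  den num : ℕ → ℕ
  den k = ∏[ j < suc k ] ∏-qint (suc j) q
  num k = ∏[ j < suc k ] ∏[ i < suc j ] qint (suc (suc i)) q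
  factorials : ∀ n → prodFact n q ≡ ∏[ k < n ∸ 1 ] ∏-qint (suc (suc k)) q
  factorials zero    = refl
  factorials (suc m) = trans (prodFact≡∏ (suc m) q) (+-identityʳ _)
  telescope : ∀ k → den k * ∏-qint (suc (suc k)) q ≡ num k
  telescope k = begin
    den k * ∏-qint (suc (suc k)) q
      ≡⟨ cong (den k *_) (∏-qint-suc (suc k) q) ⟩
    den k * ∏[ j < suc k ] qint (suc (suc j)) q
      ≡⟨ ∏<-* (λ j → ∏-qint (suc j) q) (λ j → qint (suc (suc j)) q) (suc k) ⟨
    ∏[ j < suc k ] (∏-qint (suc j) q * qint (suc (suc j)) q)
      ≡⟨ ∏<-cong (suc k) (λ {j} _ → trans (sym (∏<-suc (λ i → qint (suc i) q) (suc j))) (∏-qint-suc (suc j) q)) ⟩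
    num k ∎

InT? : ∀ n p → Dec (InT n p)
InT? n (a , b , c) = a + b + c ≤? n ∸ 2

module Triangle (n : ℕ) where

  N : ℕ
  N = n ∸ 2

  coords : List ℕ
  coords = upTo (suc n)

  column : ℕ → ℕ → List Point
  column a b = map (λ c → (a , b , c)) (filter (λ c → a + b + c ≤? N) coords)

  row : ℕ → List Point
  row a = concatMap (column a) coords

  ≤N⇒∈coords : ∀ {a} → a ≤ N → a ∈ coords
  ≤N⇒∈coords a≤N = ∈-upTo⁺ (s≤s (≤-trans a≤N (m∸n≤m n 2)))

  ∈-points⁺ : ∀ {p} → InT n p → p ∈ ptsList n
  ∈-points⁺ {a , b , c} p∈T =
    ∈-concatMap⁺′ {f = row} (≤N⇒∈coords (≤-trans (≤-trans (m≤m+n a b) (m≤m+n (a + b) c)) p∈T))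
      (∈-concatMap⁺′ {f = column a} (≤N⇒∈coords (≤-trans (≤-trans (m≤n+m b a) (m≤m+n (a + b) c)) p∈T))
        (∈-map⁺ (λ c → (a , b , c)) (∈-filter⁺ (λ c → a + b + c ≤? N) (≤N⇒∈coords (≤-trans (m≤n+m c (a + b)) p∈T)) p∈T)))

  ∈-points⁻ : ∀ {p} → p ∈ ptsList n → InT n p
  ∈-points⁻ p∈ with ∈-concatMap⁻′ row coords p∈
  ... | a , _ , p∈row with ∈-concatMap⁻′ (column a) coords p∈row
  ... | b , _ , p∈col with ∈-map⁻ (λ c → (a , b , c)) p∈col
  ... | c , c∈ , refl = proj₂ (∈-filter⁻ (λ c → a + b + c ≤? N) c∈)

  points-Unique : Unique (ptsList n)
  points-Unique = concatMap-Unique row proj₁ (Unique.upTo⁺ (suc n))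
    (λ {a} _ → concatMap-Unique (column a) (proj₁ ∘ proj₂) (Unique.upTo⁺ (suc n))
      (λ {b} _ → Unique.map⁺ (cong (proj₂ ∘ proj₂)) (Unique.filter⁺ (λ c → a + b + c ≤? N) (Unique.upTo⁺ (suc n))))
      column-b)
    row-a
    where
    column-b : ∀ {a b p} → p ∈ column a b → proj₁ (proj₂ p) ≡ b
    column-b {a} {b} p∈ with ∈-map⁻ (λ c → (a , b , c)) p∈
    ... | _ , _ , refl = refl
    row-a : ∀ {a p} → p ∈ row a → proj₁ p ≡ a
    row-a {a} p∈ with ∈-concatMap⁻′ (column a) coords p∈
    ... | b , _ , p∈col with ∈-map⁻ (λ c → (a , b , c)) p∈col
    ... | _ , _ , refl = refl

  point : Fin (size n) → Point
  point = Vec.lookup (pts n)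

  point≡lookup : ∀ i → point i ≡ List.lookup (ptsList n) i
  point≡lookup = lookup-fromList (ptsList n)

  point-InT : ∀ i → InT n (point i)
  point-InT i = subst (InT n) (sym (point≡lookup i)) (∈-points⁻ (∈-lookup i))

  point-injective : ∀ {i j} → point i ≡ point j → i ≡ j
  point-injective {i} {j} eq =
    lookup-injective points-Unique i j (trans (sym (point≡lookup i)) (trans eq (point≡lookup j)))

  position : ∀ p → InT n p → Fin (size n)
  position p p∈T = Any.index (∈-points⁺ {p} p∈T)

  point-position : ∀ {p} (p∈T : InT n p) → point (position p p∈T) ≡ p
  point-position {p} p∈T = trans (point≡lookup (position p p∈T)) (sym (lookup-index (∈-points⁺ {p} p∈T)))

  position-point : ∀ i → position (point i) (point-InT i) ≡ i
  position-point i = point-injective (point-position (point-InT i))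

  member : Subset n → Point → Bool
  member I p with InT? n p
  ... | yes p∈T = Vec.lookup I (position p p∈T)
  ... | no  _   = false

  member-position : ∀ I p (p∈T : InT n p) → member I p ≡ Vec.lookup I (position p p∈T)
  member-position I p p∈T with InT? n p
  ... | yes p∈T′ = cong (Vec.lookup I ∘ position p) (≤-irrelevant p∈T′ p∈T)
  ... | no  p∉T  = ⊥-elim (p∉T p∈T)

  member-point : ∀ I i → member I (point i) ≡ Vec.lookup I i
  member-point I i = trans (member-position I (point i) (point-InT i)) (cong (Vec.lookup I) (position-point i))

  Subset-ext : ∀ {I J} → (∀ {p} → InT n p → member I p ≡ member J p) → I ≡ J
  Subset-ext {I} {J} I≗J = trans (sym (Vec.tabulate∘lookup I)) (trans (Vec.tabulate-cong same) (Vec.tabulate∘lookup J))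
    where
    same : ∀ i → Vec.lookup I i ≡ Vec.lookup J i
    same i = trans (sym (member-point I i)) (trans (I≗J {point i} (point-InT i)) (member-point J i))

  -- Keys with a + b > N index empty chains; keeping them makes keys a full grid.
  Key : Set
  Key = ℕ × ℕ

  keys : List Key
  keys = concatMap (λ a → map (a ,_) coords) coords

  keys-Unique : Unique keys
  keys-Unique = concatMap-Unique (λ a → map (a ,_) coords) proj₁ (Unique.upTo⁺ (suc n))
    (λ _ → Unique.map⁺ (cong proj₂) (Unique.upTo⁺ (suc n))) first
    where
    first : ∀ {a k} → k ∈ map (a ,_) coords → proj₁ k ≡ a
    first {a} k∈ with ∈-map⁻ (a ,_) k∈
    ... | _ , _ , refl = refl

  ∈-keys : ∀ {a b} → a ∈ coords → b ∈ coords → (a , b) ∈ keys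
  ∈-keys {a} a∈ b∈ = ∈-concatMap⁺′ {f = λ a → map (a ,_) coords} a∈ (∈-map⁺ (a ,_) b∈)

  -- The vertical chain over (a , b) is {(a , b , c) | c < chainLength (a , b)}.
  chainLength : Key → ℕ
  chainLength (a , b) = suc N ∸ (a + b)

  chainLength≤ : ∀ k → chainLength k ≤ suc n
  chainLength≤ (a , b) = ≤-trans (m∸n≤m (suc N) (a + b)) (s≤s (m∸n≤m n 2))

  <chainLength⇒InT : ∀ a b {c} → c < chainLength (a , b) → InT n (a , b , c)
  <chainLength⇒InT a b c< = s≤s⁻¹ (<∸⇒+< (suc N) (a + b) c<)

  InT⇒<chainLength : ∀ {a b c} → InT n (a , b , c) → c < chainLength (a , b)
  InT⇒<chainLength {a} {b} {c} p∈T =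
    m+n≤o⇒m≤o∸n (suc c) (subst (_≤ suc N) (cong suc (+-comm (a + b) c)) (s≤s p∈T))

  sum-column : ∀ a b (F : Point → ℕ) → sum (map F (column a b)) ≡ ∑[ c < chainLength (a , b) ] F (a , b , c)
  sum-column a b F = begin
    sum (map F (column a b))
      ≡⟨ cong sum (map-∘ (filter (λ c → a + b + c ≤? N) coords)) ⟨
    sum (map (λ c → F (a , b , c)) (filter (λ c → a + b + c ≤? N) coords))
      ≡⟨ cong (λ cs → sum (map (λ c → F (a , b , c)) cs)) (filter-upTo (a + b) N (suc n)) ⟩
    sum (map (λ c → F (a , b , c)) (upTo (suc n ⊓ chainLength (a , b))))
      ≡⟨ cong (λ m → sum (map (λ c → F (a , b , c)) (upTo m))) (m≥n⇒m⊓n≡n (chainLength≤ (a , b))) ⟩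
    sum (map (λ c → F (a , b , c)) (upTo (chainLength (a , b))))
      ≡⟨ sum-map-upTo (λ c → F (a , b , c)) (chainLength (a , b)) ⟩
    ∑[ c < chainLength (a , b) ] F (a , b , c) ∎
    where open ≡-Reasoning

  sum-points : ∀ (F : Point → ℕ) →
    sum (map F (ptsList n)) ≡ sum (map (λ a → sum (map (λ b → sum (map F (column a b))) coords)) coords)
  sum-points F = begin
    sum (map F (concatMap row coords))
      ≡⟨ sum-concatMap F row coords ⟩
    sum (map (λ a → sum (map F (row a))) coords)
      ≡⟨ cong sum (map-cong (λ a → sum-concatMap F (column a) coords) coords) ⟩
    sum (map (λ a → sum (map (λ b → sum (map F (column a b))) coords)) coords) ∎
    where open ≡-Reasoning

  sum-keys : ∀ (F : Key → ℕ) → sum (map F keys) ≡ sum (map (λ a → sum (map (λ b → F (a , b)) coords)) coords)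
  sum-keys F = begin
    sum (map F (concatMap (λ a → map (a ,_) coords) coords))
      ≡⟨ sum-concatMap F (λ a → map (a ,_) coords) coords ⟩
    sum (map (λ a → sum (map F (map (a ,_) coords))) coords)
      ≡⟨ cong sum (map-cong (λ a → cong sum (sym (map-∘ coords))) coords) ⟩
    sum (map (λ a → sum (map (λ b → F (a , b)) coords)) coords) ∎
    where open ≡-Reasoning

-- Grouping the chains by a, the chains over (a , b), b ≤ n - 1 - a, contribute (n - a)!_q.
product-chainLengths : ∀ n → 2 ≤ n → ∀ q →
  product (map (λ k → qint (suc (Triangle.chainLength n k)) q) (Triangle.keys n)) ≡ prodFact n q
product-chainLengths (suc zero)      (s≤s ()) q
product-chainLengths n@(suc (suc m)) _        q = begin
  product (map G (concatMap (λ a → map (a ,_) coords) coords))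
    ≡⟨ product-concatMap G (λ a → map (a ,_) coords) coords ⟩
  product (map (λ a → product (map G (map (a ,_) coords))) coords)
    ≡⟨ product-map-upTo (λ a → product (map G (map (a ,_) coords))) (suc n) ⟩
  ∏[ a < suc n ] product (map G (map (a ,_) coords))
    ≡⟨ ∏<-cong (suc n) chains-over ⟩
  ∏[ a < suc n ] ∏-qint (suc (M ∸ a)) q
    ≡⟨ ∏<-suc (λ a → ∏-qint (suc (M ∸ a)) q) n ⟩
  (∏[ a < n ] ∏-qint (suc (M ∸ a)) q) * ∏-qint (suc (M ∸ n)) q
    ≡⟨ cong (λ z → (∏[ a < n ] ∏-qint (suc (M ∸ a)) q) * ∏-qint (suc z) q) (m≤n⇒m∸n≡0 (n≤1+n M)) ⟩
  (∏[ a < n ] ∏-qint (suc (n ∸ suc a)) q) * 1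
    ≡⟨ *-identityʳ _ ⟩
  ∏[ a < n ] ∏-qint (suc (n ∸ suc a)) q
    ≡⟨ ∏<-reverse (λ j → ∏-qint (suc j) q) n ⟩
  ∏[ j < n ] ∏-qint (suc j) q
    ≡⟨ prodFact≡∏ n q ⟨
  prodFact n q ∎
  where
  open ≡-Reasoning
  open Triangle n using (Key; keys; coords; chainLength)
  M = suc m
  G : Key → ℕ
  G k = qint (suc (chainLength k)) q
  chains-over : ∀ {a} → a < suc n → product (map G (map (a ,_) coords)) ≡ ∏-qint (suc (M ∸ a)) q
  chains-over {a} a< = begin
    product (map G (map (a ,_) coords))
      ≡⟨ cong product (map-∘ {g = G} {f = a ,_} coords) ⟨
    product (map (λ b → G (a , b)) coords)
      ≡⟨ product-map-upTo (λ b → G (a , b)) (suc n) ⟩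
    ∏[ b < suc n ] qint (suc (M ∸ (a + b))) q
      ≡⟨ ∏<-cong (suc n) (λ {b} _ → cong (λ z → qint (suc z) q) (sym (∸-+-assoc M a b))) ⟩
    ∏[ b < suc n ] qint (suc (M ∸ a ∸ b)) q
      ≡⟨ ∏-qint-∸ q (s≤s (≤-trans (m∸n≤m M a) (n≤1+n M))) ⟩
    ∏-qint (suc (M ∸ a)) q ∎

module CoverClosure (n : ℕ) (x : Color) where
  open Triangle n

  CoverClosed : Subset n → Set
  CoverClosed I = ∀ {p p′} → Cover n x p p′ → member I p′ ≡ true → member I p ≡ true

  CoverClosed⇒IsIdeal : ∀ {I} → CoverClosed I → IsIdeal n x I
  CoverClosed⇒IsIdeal {I} closed i j i≤j j∈I =
    trans (sym (member-point I i)) (down i≤j (trans (member-point I j) j∈I))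
    where
    down : ∀ {p p′} → Le n x p p′ → member I p′ ≡ true → member I p ≡ true
    down ε         p′∈I = p′∈I
    down (c ◅ p≤p′) p′∈I = closed c (down p≤p′ p′∈I)

  IsIdeal⇒CoverClosed : ∀ {I} → IsIdeal n x I → CoverClosed I
  IsIdeal⇒CoverClosed {I} ideal {p} {p′} c@(p∈T , p′∈T , _) p′∈I =
    trans (member-position I p p∈T)
      (ideal (position p p∈T) (position p′ p′∈T) cover (trans (sym (member-position I p′ p′∈T)) p′∈I))
    where
    cover : Le n x (point (position p p∈T)) (point (position p′ p′∈T))
    cover = subst₂ (Le n x) (sym (point-position p∈T)) (sym (point-position p′∈T)) (c ◅ ε)

record Verticalisation (n : ℕ) (x : Color) : Set where
  field
    to from   : Point → Point
    to-InT    : ∀ {p} → InT n p → InT n (to p)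
    from-InT  : ∀ {p} → InT n p → InT n (from p)
    from∘to   : ∀ {p} → InT n p → from (to p) ≡ p
    to∘from   : ∀ {p} → InT n p → to (from p) ≡ p
    to-step   : ∀ {p p′} → Cover n x p p′ → Step cy (to p) (to p′)
    from-step : ∀ {q q′} → InT n q′ → Step cy q q′ → Step x (from q) (from q′)

module ChainDecomposition {n : ℕ} {x : Color} (V : Verticalisation n x) where
  open Triangle n
  open CoverClosure n x
  open Verticalisation V
  open AssocList (≡-dec Data.Nat._≟_ Data.Nat._≟_)
  open BoundedVectors chainLength

  InVerticalDownset : List ℕ → Point → Bool
  InVerticalDownset hs (a , b , c) = c <ᵇ valueAt keys hs (a , b)

  downset : List ℕ → Subset n
  downset hs = Vec.map (InVerticalDownset hs ∘ to) (pts n)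

  member-downset : ∀ hs p → InT n p → member (downset hs) p ≡ InVerticalDownset hs (to p)
  member-downset hs p p∈T = begin
    member (downset hs) p                         ≡⟨ member-position (downset hs) p p∈T ⟩
    Vec.lookup (downset hs) (position p p∈T)       ≡⟨ Vec.lookup-map (position p p∈T) _ (pts n) ⟩
    InVerticalDownset hs (to (point (position p p∈T))) ≡⟨ cong (InVerticalDownset hs ∘ to) (point-position p∈T) ⟩
    InVerticalDownset hs (to p)                   ∎
    where open ≡-Reasoning

  downset-CoverClosed : ∀ hs → CoverClosed (downset hs)
  downset-CoverClosed hs {p} {p′} c@(p∈T , p′∈T , _) p′∈I =
    trans (member-downset hs p p∈T) (below (to-step c) (trans (sym (member-downset hs p′ p′∈T)) p′∈I))
    where
    below : ∀ {q q′} → Step cy q q′ → InVerticalDownset hs q′ ≡ true → InVerticalDownset hs q ≡ true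
    below (step-y {a} {b} {c}) = <ᵇ-pred c (valueAt keys hs (a , b))

  chainCount : Subset n → Key → ℕ
  chainCount I (a , b) = count (chainLength (a , b)) (λ c → member I (from (a , b , c)))

  heights : Subset n → List ℕ
  heights I = map (chainCount I) keys

  heights-Bounded : ∀ I → Bounded keys (heights I)
  heights-Bounded I = map-Bounded (λ { (a , b) → count-≤ (chainLength (a , b)) _ }) keys

  heights-downset : ∀ {hs} → Bounded keys hs → heights (downset hs) ≡ hs
  heights-downset {hs} bnd = trans (map-cong-local (All.tabulate chainCount-downset)) (map-valueAt keys-Unique bnd)
    where
    chainCount-downset : ∀ {k} → k ∈ keys → chainCount (downset hs) k ≡ valueAt keys hs k
    chainCount-downset {a , b} k∈ = trans (∑<-cong (chainLength (a , b)) on-chain) (count-<ᵇ (valueAt-Pointwise bnd k∈))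
      where
      on-chain : ∀ {c} → c < chainLength (a , b) →
        toℕ (member (downset hs) (from (a , b , c))) ≡ toℕ (c <ᵇ valueAt keys hs (a , b))
      on-chain c< = cong toℕ (trans (member-downset hs _ (from-InT (<chainLength⇒InT a b c<)))
                                    (cong (InVerticalDownset hs) (to∘from (<chainLength⇒InT a b c<))))

  downset-heights : ∀ {I} → CoverClosed I → downset (heights I) ≡ I
  downset-heights {I} closed = Subset-ext λ {p} p∈T → begin
    member (downset (heights I)) p          ≡⟨ member-downset (heights I) p p∈T ⟩
    InVerticalDownset (heights I) (to p)    ≡⟨ on-chain (to p) (to-InT p∈T) ⟩
    member I (from (to p))                  ≡⟨ cong (member I) (from∘to p∈T) ⟩
    member I p                              ∎
    where
    open ≡-Reasoning
    -- I is down-closed along each vertical chain, hence an initial segment of it.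
    on-chain : ∀ q → InT n q → InVerticalDownset (heights I) q ≡ member I (from q)
    on-chain (a , b , c) q∈T = sym (begin
      member I (from (a , b , c))    ≡⟨ downClosed⇒initialSegment chain-closed (InT⇒<chainLength {a} {b} q∈T) ⟩
      c <ᵇ chainCount I (a , b)      ≡⟨ cong (c <ᵇ_) (valueAt-map (chainCount I) (∈-keys a∈ b∈)) ⟨
      c <ᵇ valueAt keys (heights I) (a , b) ∎)
      where
      a∈ = ≤N⇒∈coords (≤-trans (≤-trans (m≤m+n a b) (m≤m+n (a + b) c)) q∈T)
      b∈ = ≤N⇒∈coords (≤-trans (≤-trans (m≤n+m b a) (m≤m+n (a + b) c)) q∈T)
      chain-closed : DownClosedBelow (chainLength (a , b)) (λ c → member I (from (a , b , c)))
      chain-closed {j} sj< = closed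
        ( from-InT (<chainLength⇒InT a b (<-trans (n<1+n j) sj<))
        , from-InT (<chainLength⇒InT a b sj<)
        , from-step (<chainLength⇒InT a b sj<) step-y)

  sum-map-to : ∀ (F : Point → ℕ) → sum (map F (map to (ptsList n))) ≡ sum (map F (ptsList n))
  sum-map-to F = sum-map-Unique-sameElements F to-Unique points-Unique to∈ ∈to
    where
    to-Unique : Unique (map to (ptsList n))
    to-Unique = map-Unique-injectiveOn to
      (λ p∈ p′∈ eq → trans (sym (from∘to (∈-points⁻ p∈))) (trans (cong from eq) (from∘to (∈-points⁻ p′∈))))
      points-Unique
    to∈ : ∀ {q} → q ∈ map to (ptsList n) → q ∈ ptsList n
    to∈ q∈ with ∈-map⁻ to q∈
    ... | p , p∈ , refl = ∈-points⁺ (to-InT (∈-points⁻ p∈))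
    ∈to : ∀ {q} → q ∈ ptsList n → q ∈ map to (ptsList n)
    ∈to {q} q∈ = subst (_∈ map to (ptsList n)) (to∘from (∈-points⁻ q∈)) (∈-map⁺ to (∈-points⁺ {from q} (from-InT (∈-points⁻ q∈))))

  card-downset : ∀ {hs} → Bounded keys hs → card (downset hs) ≡ sum hs
  card-downset {hs} bnd = begin
    sum (map toℕ (Vec.toList (Vec.map (F ∘ to) (pts n))))
      ≡⟨ cong (sum ∘ map toℕ) (trans (Vec.toList-map (F ∘ to) (pts n)) (cong (map (F ∘ to)) (Vec.toList∘fromList (ptsList n)))) ⟩
    sum (map toℕ (map (F ∘ to) (ptsList n)))
      ≡⟨ cong sum (trans (sym (map-∘ {g = toℕ} {f = F ∘ to} (ptsList n))) (map-∘ {g = toℕ ∘ F} {f = to} (ptsList n))) ⟩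
    sum (map (toℕ ∘ F) (map to (ptsList n)))
      ≡⟨ sum-map-to (toℕ ∘ F) ⟩
    sum (map (toℕ ∘ F) (ptsList n))
      ≡⟨ sum-points (toℕ ∘ F) ⟩
    sum (map (λ a → sum (map (λ b → sum (map (toℕ ∘ F) (column a b))) coords)) coords)
      ≡⟨ cong sum (map-cong-local (All.tabulate λ a∈ → cong sum (map-cong-local (All.tabulate λ b∈ → on-column a∈ b∈)))) ⟩
    sum (map (λ a → sum (map (λ b → valueAt keys hs (a , b)) coords)) coords)
      ≡⟨ sum-keys (valueAt keys hs) ⟨
    sum (map (valueAt keys hs) keys)
      ≡⟨ cong sum (map-valueAt keys-Unique bnd) ⟩
    sum hs ∎
    where
    open ≡-Reasoning
    F = InVerticalDownset hs
    on-column : ∀ {a b} → a ∈ coords → b ∈ coords → sum (map (toℕ ∘ F) (column a b)) ≡ valueAt keys hs (a , b)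
    on-column {a} {b} a∈ b∈ = trans (sum-column a b (toℕ ∘ F)) (count-<ᵇ (valueAt-Pointwise bnd (∈-keys a∈ b∈)))

  ideals : List (Subset n)
  ideals = map downset (boundedVectors keys)

  ideals-enumerate : EnumeratesJ n x ideals
  ideals-enumerate =
      All.map⁺ (All.universal (λ hs → CoverClosed⇒IsIdeal (downset-CoverClosed hs)) _)
    , map-Unique-injectiveOn downset downset-injective (boundedVectors-Unique keys)
    , λ I ideal → subst (_∈ ideals) (downset-heights (IsIdeal⇒CoverClosed ideal))
                    (∈-map⁺ downset (∈-boundedVectors⁺ (heights-Bounded I)))
    where
    downset-injective : ∀ {hs hs′} → hs ∈ boundedVectors keys → hs′ ∈ boundedVectors keys →
      downset hs ≡ downset hs′ → hs ≡ hs′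
    downset-injective hs∈ hs′∈ eq =
      trans (sym (heights-downset (∈-boundedVectors⁻ keys hs∈)))
        (trans (cong heights eq) (heights-downset (∈-boundedVectors⁻ keys hs′∈)))

  genF-ideals : ∀ q → genF n ideals q ≡ product (map (λ k → qint (suc (chainLength k)) q) keys)
  genF-ideals q = begin
    sum (map (λ I → q ^ card I) (map downset (boundedVectors keys)))
      ≡⟨ cong sum (map-∘ (boundedVectors keys)) ⟨
    sum (map (λ hs → q ^ card (downset hs)) (boundedVectors keys))
      ≡⟨ cong sum (map-cong-local (All.tabulate λ hs∈ → cong (q ^_) (card-downset (∈-boundedVectors⁻ keys hs∈)))) ⟩
    sum (map (λ hs → q ^ sum hs) (boundedVectors keys))
      ≡⟨ sum-boundedVectors q keys ⟩
    product (map (λ k → qint (suc (chainLength k)) q) keys) ∎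
    where open ≡-Reasoning

-- The six verticalisations

reflect-≤ : ∀ {N s} w r → s ≡ w + r → s ≤ N → N ∸ s + r ≤ N
reflect-≤ {N} {s} w r refl s≤N = ≤-trans (+-monoʳ-≤ (N ∸ s) (m≤n+m r w)) (≤-reflexive (m∸n+n≡m s≤N))

reflect-∸ : ∀ {N s} w r → s ≡ w + r → s ≤ N → N ∸ (N ∸ s + r) ≡ w
reflect-∸ {N} {s} w r refl s≤N = begin
  N ∸ (N ∸ s + r)    ≡⟨ ∸-+-assoc N (N ∸ s) r ⟨
  N ∸ (N ∸ s) ∸ r    ≡⟨ cong (_∸ r) (m∸[m∸n]≡n s≤N) ⟩
  w + r ∸ r          ≡⟨ m+n∸n≡m w r ⟩
  w                  ∎
  where open ≡-Reasoning

reflect-suc : ∀ {N} a b c → a + b + suc c ≤ N → N ∸ (a + b + c) ≡ suc (N ∸ (a + b + suc c))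
reflect-suc a b c h rewrite +-suc (a + b) c = +-∸-assoc 1 h

module Verticalisations (n : ℕ) where

  N : ℕ
  N = n ∸ 2

  vertical-y : Verticalisation n cy
  vertical-y = record
    { to = id ; from = id ; to-InT = id ; from-InT = id ; from∘to = λ _ → refl ; to∘from = λ _ → refl
    ; to-step = λ { (_ , _ , step-y) → step-y } ; from-step = λ _ st → st }

  vertical-r : Verticalisation n cr
  vertical-r = record
    { to = λ { (a , b , c) → (b , c , a) } ; from = λ { (a , b , c) → (c , a , b) }
    ; to-InT = λ { {a , b , c} → subst (_≤ N) (xy∙z≈yz∙x a b c) }
    ; from-InT = λ { {a , b , c} → subst (_≤ N) (xy∙z≈zx∙y a b c) }
    ; from∘to = λ _ → refl ; to∘from = λ _ → refl
    ; to-step = λ { (_ , _ , step-r) → step-y } ; from-step = λ { _ step-y → step-r } }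

  vertical-g : Verticalisation n cg
  vertical-g = record
    { to = swap ; from = swap
    ; to-InT = λ { {a , b , c} → subst (_≤ N) (xy∙z≈xz∙y a b c) }
    ; from-InT = λ { {a , b , c} → subst (_≤ N) (xy∙z≈xz∙y a b c) }
    ; from∘to = λ _ → refl ; to∘from = λ _ → refl
    ; to-step = λ { (_ , _ , step-g) → step-y } ; from-step = λ { _ step-y → step-g } }
    where
    swap : Point → Point
    swap (a , b , c) = (a , c , b)

  vertical-o : Verticalisation n co
  vertical-o = record
    { to = reflect ; from = reflect ; to-InT = λ {p} → reflect-InT {p} ; from-InT = λ {p} → reflect-InT {p}
    ; from∘to = λ {p} → involutive {p} ; to∘from = λ {p} → involutive {p}
    ; to-step = λ { (_ , _ , step-o {a} {b} {c}) →
        subst (λ z → Step cy (N ∸ z , b , c) (N ∸ (a + b + suc c) , b , suc c)) (+-suc (a + b) c) step-y }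
    ; from-step = λ { {a , b , c} h step-y →
        subst (λ z → Step co (z , b , c) (N ∸ (a + b + suc c) , b , suc c)) (sym (reflect-suc a b c h)) step-o } }
    where
    reflect : Point → Point
    reflect (a , b , c) = (N ∸ (a + b + c) , b , c)
    reflect-InT : ∀ {p} → InT n p → InT n (reflect p)
    reflect-InT {a , b , c} h = subst (_≤ N) (sym (+-assoc (N ∸ (a + b + c)) b c)) (reflect-≤ a (b + c) (+-assoc a b c) h)
    involutive : ∀ {p} → InT n p → reflect (reflect p) ≡ p
    involutive {a , b , c} h =
      cong (_, b , c) (trans (cong (N ∸_) (+-assoc (N ∸ (a + b + c)) b c)) (reflect-∸ a (b + c) (+-assoc a b c) h))

  vertical-b : Verticalisation n cb
  vertical-b = record
    { to = reflect ; from = reflect ; to-InT = λ {p} → reflect-InT {p} ; from-InT = λ {p} → reflect-InT {p}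
    ; from∘to = λ {p} → involutive {p} ; to∘from = λ {p} → involutive {p}
    ; to-step = λ { (_ , _ , step-b {a} {b} {c}) →
        subst (λ z → Step cy (N ∸ z , c , b) (N ∸ (a + suc b + c) , c , suc b)) (cong (_+ c) (+-suc a b)) step-y }
    ; from-step = λ { {a , b , c} h step-y →
        subst (λ z → Step cb (z , c , b) (N ∸ (a + b + suc c) , suc c , b)) (sym (reflect-suc a b c h)) step-b } }
    where
    reflect : Point → Point
    reflect (a , b , c) = (N ∸ (a + b + c) , c , b)
    reflect-InT : ∀ {p} → InT n p → InT n (reflect p)
    reflect-InT {a , b , c} h = subst (_≤ N) (sym (+-assoc (N ∸ (a + b + c)) c b)) (reflect-≤ a (c + b) (xy∙z≈x∙zy a b c) h)
    involutive : ∀ {p} → InT n p → reflect (reflect p) ≡ p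
    involutive {a , b , c} h =
      cong (_, b , c) (trans (cong (N ∸_) (+-assoc (N ∸ (a + b + c)) c b)) (reflect-∸ a (c + b) (xy∙z≈x∙zy a b c) h))

  vertical-s : Verticalisation n cs
  vertical-s = record
    { to = to ; from = from ; to-InT = λ {p} → to-InT {p} ; from-InT = λ {p} → from-InT {p}
    ; from∘to = λ {p} → from∘to {p} ; to∘from = λ {p} → to∘from {p}
    ; to-step = λ { (_ , _ , step-s {a} {b} {c}) →
        subst (λ z → Step cy (a , N ∸ (a + b + suc c) , b) (a , N ∸ z , suc b))
          (trans (+-suc (a + b) c) (sym (cong (_+ c) (+-suc a b)))) step-y }
    ; from-step = λ { {a , b , c} h step-y →
        subst (λ z → Step cs (a , c , z) (a , suc c , N ∸ (a + b + suc c))) (sym (reflect-suc a b c h)) step-s } }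
    where
    to from : Point → Point
    to   (a , b , c) = (a , N ∸ (a + b + c) , b)
    from (a , b , c) = (a , c , N ∸ (a + b + c))
    to-InT : ∀ {p} → InT n p → InT n (to p)
    to-InT {a , b , c} h = subst (_≤ N) (sym (xy∙z≈y∙xz a (N ∸ (a + b + c)) b)) (reflect-≤ c (a + b) (xy∙z≈z∙xy a b c) h)
    from-InT : ∀ {p} → InT n p → InT n (from p)
    from-InT {a , b , c} h = subst (_≤ N) (+-comm (N ∸ (a + b + c)) (a + c)) (reflect-≤ b (a + c) (xy∙z≈y∙xz a b c) h)
    from∘to : ∀ {p} → InT n p → from (to p) ≡ p
    from∘to {a , b , c} h =
      cong (λ z → a , b , z) (trans (cong (N ∸_) (xy∙z≈y∙xz a (N ∸ (a + b + c)) b)) (reflect-∸ c (a + b) (xy∙z≈z∙xy a b c) h))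
    to∘from : ∀ {p} → InT n p → to (from p) ≡ p
    to∘from {a , b , c} h =
      cong (λ z → a , z , c) (trans (cong (N ∸_) (+-comm (a + c) (N ∸ (a + b + c)))) (reflect-∸ b (a + c) (xy∙z≈y∙xz a b c) h))

verticalisation : ∀ n x → Verticalisation n x
verticalisation n cr = Verticalisations.vertical-r n
verticalisation n cg = Verticalisations.vertical-g n
verticalisation n cy = Verticalisations.vertical-y n
verticalisation n cb = Verticalisations.vertical-b n
verticalisation n co = Verticalisations.vertical-o n
verticalisation n cs = Verticalisations.vertical-s n

theorem7 : (n : ℕ) → 2 ≤ n → (x : Color) →
    ∃[ L ] (EnumeratesJ n x L ×
    ((q : ℕ) → (genF n L q ≡ prodFact n q) × (prodFact n q * prodDen n q ≡ prodNum n q)))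
theorem7 n 2≤n x =
    ideals
  , ideals-enumerate
  , λ q → trans (genF-ideals q) (product-chainLengths n 2≤n q) , prodFact*prodDen≡prodNum n q
  where open ChainDecomposition (verticalisation n x)
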